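{- For every set of formulas $\Gamma\cup\{\alpha\}$: if $\Gamma\vdash_{L_1^0}\alpha$, then $\Gamma\vDash_{\mathcal{M}_1^0}\alpha$.
   Context: Formulas are built from propositional variables $p_1,p_2,\dots$ using unary connectives $\neg$, $\circ$ and binary connectives $\land,\lor,\to$. Write $\circ^0\alpha=\alpha$, $\circ^{m+1}\alpha=\circ\circ^m\alpha$, and $\alpha\leftrightarrow\beta:=(\alpha\to\beta)\land(\beta\to\alpha)$. All logics are Hilbert calculi whose only rule is modus ponens, axioms being schemas; $\Gamma\vdash_L\alpha$ means $\alpha$ is derivable from $\Gamma$ in $L$. The logic mbC has the axioms of positive classical logic: $\alpha\to(\beta\to\alpha)$; $(\alpha\to\beta)\to((\alpha\to(\beta\to\gamma))\to(\alpha\to\gamma))$; $\alpha\to(\beta\to(\alpha\land\beta))$; $(\alpha\land\beta)\to\alpha$; $(\alpha\land\beta)\to\beta$; $\alpha\to(\alpha\lor\beta)$; $\beta\to(\alpha\lor\beta)$; $(\alpha\to\gamma)\to((\beta\to\gamma)\to((\alpha\lor\beta)\to\gamma))$; $\alpha\lor(\alpha\to\beta)$; plus (TND) $\alpha\lor\neg\alpha$ and (bc1) $\circ\alpha\to(\alpha\to(\neg\alpha\to\beta))$. mbCciw is mbC plus (ciw) $\circ\alpha\lor(\alpha\land\neg\alpha)$. $L_1^0$ is mbCciw plus the axiom $\circ\circ\circ\alpha$. A multialgebra (Nmatrix) semantics: given a domain with multioperations (each returning a nonempty subset of the domain) and a set $D$ of designated elements, a valuation is a map $v$ from formulas to the domain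 with $v(\neg\alpha)\in\neg v(\alpha)$, $v(\circ\alpha)\in\circ v(\alpha)$, $v(\alpha\#\beta)\in v(\alpha)\#v(\beta)$ for $\#\in\{\land,\lor,\to\}$; $\Gamma\vDash\alpha$ iff every valuation with $v[\Gamma]\subseteq D$ has $v(\alpha)\in D$. $\mathcal{M}_1^0$: with Boolean operations $\land,\lor,\to,\sim$ on $\{0,1\}$, the domain is $\mathbb{B}_1^0=\{x=(x_1,x_2,x_3)\in\{0,1\}^3: x_1\lor x_2=1\text{ and }x_3\lor\sim(x_1\land x_2)=1\}=\{(1,0,0),(1,0,1),(1,1,1),(0,1,1),(0,1,0)\}$; multioperations: $x\#y=\{z\in\mathbb{B}_1^0: z_1=x_1\#y_1\}$ for $\#\in\{\land,\lor,\to\}$; $\neg x=\{z\in\mathbb{B}_1^0:z_1=x_2\}$; $\circ x=\{(\sim(x_1\land x_2),\,x_3,\,x_3\land\sim(x_1\land x_2))\}$; designated set $D_1^0=\{x\in\mathbb{B}_1^0:x_1=1\}$. $\vDash_{\mathcal{M}_1^0}$ is its consequence relation. -}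

module Defs where

open import Data.Nat using (ℕ)
open import Data.Bool using (Bool; true; false; _∧_; _∨_; not)
open import Data.Product using (_×_; _,_; proj₁; proj₂)
open import Relation.Binary.PropositionalEquality using (_≡_)

infixr 5 _⇒_
infixl 6 _∨ᶠ_
infixl 7 _∧ᶠ_

data Formula : Set where
  var   : ℕ → Formula
  ¬ᶠ_   : Formula → Formula
  ∘ᶠ_   : Formula → Formula
  _∧ᶠ_  : Formula → Formula → Formula
  _∨ᶠ_  : Formula → Formula → Formula
  _⇒_   : Formula → Formula → Formula

FSet : Set₁
FSet = Formula → Set

-- Axiom schemas of L₁⁰ = mbC + (ciw) + ∘∘∘α

data AxiomL10 : Formula → Set where
  ax1  : ∀ α β → AxiomL10 (α ⇒ (β ⇒ α))
  ax2  : ∀ α β γ → AxiomL10 ((α ⇒ β) ⇒ ((α ⇒ (β ⇒ γ)) ⇒ (α ⇒ γ)))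
  ax3  : ∀ α β → AxiomL10 (α ⇒ (β ⇒ (α ∧ᶠ β)))
  ax4  : ∀ α β → AxiomL10 ((α ∧ᶠ β) ⇒ α)
  ax5  : ∀ α β → AxiomL10 ((α ∧ᶠ β) ⇒ β)
  ax6  : ∀ α β → AxiomL10 (α ⇒ (α ∨ᶠ β))
  ax7  : ∀ α β → AxiomL10 (β ⇒ (α ∨ᶠ β))
  ax8  : ∀ α β γ → AxiomL10 ((α ⇒ γ) ⇒ ((β ⇒ γ) ⇒ ((α ∨ᶠ β) ⇒ γ)))
  ax9  : ∀ α β → AxiomL10 (α ∨ᶠ (α ⇒ β))
  tnd  : ∀ α → AxiomL10 (α ∨ᶠ (¬ᶠ α))
  bc1  : ∀ α β → AxiomL10 ((∘ᶠ α) ⇒ (α ⇒ ((¬ᶠ α) ⇒ β)))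
  ciw  : ∀ α → AxiomL10 ((∘ᶠ α) ∨ᶠ (α ∧ᶠ (¬ᶠ α)))
  ooo  : ∀ α → AxiomL10 (∘ᶠ (∘ᶠ (∘ᶠ α)))

data _⊢L10_ (Γ : FSet) : Formula → Set where
  premise : ∀ {α} → Γ α → Γ ⊢L10 α
  axiom   : ∀ {α} → AxiomL10 α → Γ ⊢L10 α
  mp      : ∀ {α β} → Γ ⊢L10 α → Γ ⊢L10 (α ⇒ β) → Γ ⊢L10 β

Triple : Set
Triple = Bool × Bool × Bool

fst snd thd : Triple → Bool
fst (a , _ , _) = a
snd (_ , b , _) = b
thd (_ , _ , c) = c

_⇒ᵇ_ : Bool → Bool → Bool
a ⇒ᵇ b = not a ∨ b

InB10 : Triple → Set
InB10 (x₁ , x₂ , x₃) = ((x₁ ∨ x₂) ≡ true) × ((x₃ ∨ not (x₁ ∧ x₂)) ≡ true)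

-- membership z ∈ x ⊛ y for the multioperations (z ranges over 𝔹₁⁰)
InAnd InOr InImp : Triple → Triple → Triple → Set
InAnd x y z = InB10 z × (fst z ≡ (fst x ∧ fst y))
InOr  x y z = InB10 z × (fst z ≡ (fst x ∨ fst y))
InImp x y z = InB10 z × (fst z ≡ (fst x ⇒ᵇ fst y))

InNeg : Triple → Triple → Set
InNeg x z = InB10 z × (fst z ≡ snd x)

InCirc : Triple → Triple → Set
InCirc x z = z ≡ (not (fst x ∧ snd x) , thd x , (thd x ∧ not (fst x ∧ snd x)))

Designated : Triple → Set
Designated x = fst x ≡ true

record Valuation : Set where
  field
    v      : Formula → Triple
    inB    : ∀ φ → InB10 (v φ)
    v-neg  : ∀ α → InNeg (v α) (v (¬ᶠ α))
    v-circ : ∀ α → InCirc (v α) (v (∘ᶠ α))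
    v-and  : ∀ α β → InAnd (v α) (v β) (v (α ∧ᶠ β))
    v-or   : ∀ α β → InOr (v α) (v β) (v (α ∨ᶠ β))
    v-imp  : ∀ α β → InImp (v α) (v β) (v (α ⇒ β))

_⊨M10_ : FSet → Formula → Set
Γ ⊨M10 α = (val : Valuation) →
  (∀ γ → Γ γ → Designated (Valuation.v val γ)) → Designated (Valuation.v val α)

{-# OPTIONS --safe #-}
module Submission where

open import Defs
open import Data.Bool using (Bool; true; false; _∧_; _∨_; not)
open import Data.Bool.Properties using (∨-zeroʳ; ∨-inverseˡ; ∧-inverseˡ; ∧-comm)
open import Data.Product using (_,_; proj₁; proj₂)
open import Relation.Binary.PropositionalEquality
  using (_≡_; refl; sym; trans; cong; cong₂; subst; module ≡-Reasoning)
open ≡-Reasoning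

-- Designation only looks at first coordinates, on which ∧, ∨, ⇒ act as the
-- Boolean operations and ¬ reads off the second coordinate.  So every mbCciw
-- axiom is designated because it is a tautology of Bool once ¬α and ∘α are
-- replaced by their first coordinates (b and ∼(a ∧ b) for v α = (a , b , c)).
-- For ∘∘∘α: the first two coordinates of any ∘∘x are complementary, so its
-- ∘-image has first coordinate ∼(∼s ∧ s) = 1.

⇒ᵇ-K : ∀ a b → (a ⇒ᵇ (b ⇒ᵇ a)) ≡ true
⇒ᵇ-K false b = refl
⇒ᵇ-K true  b = ∨-zeroʳ (not b)

⇒ᵇ-S : ∀ a b c → ((a ⇒ᵇ b) ⇒ᵇ ((a ⇒ᵇ (b ⇒ᵇ c)) ⇒ᵇ (a ⇒ᵇ c))) ≡ true
⇒ᵇ-S false b     c = refl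
⇒ᵇ-S true  false c = refl
⇒ᵇ-S true  true  c = ∨-inverseˡ c

⇒ᵇ-∧-intro : ∀ a b → (a ⇒ᵇ (b ⇒ᵇ (a ∧ b))) ≡ true
⇒ᵇ-∧-intro false b = refl
⇒ᵇ-∧-intro true  b = ∨-inverseˡ b

⇒ᵇ-∧-elimˡ : ∀ a b → ((a ∧ b) ⇒ᵇ a) ≡ true
⇒ᵇ-∧-elimˡ false b = refl
⇒ᵇ-∧-elimˡ true  b = ∨-zeroʳ (not b)

⇒ᵇ-∧-elimʳ : ∀ a b → ((a ∧ b) ⇒ᵇ b) ≡ true
⇒ᵇ-∧-elimʳ false b = refl
⇒ᵇ-∧-elimʳ true  b = ∨-inverseˡ b

⇒ᵇ-∨-introˡ : ∀ a b → (a ⇒ᵇ (a ∨ b)) ≡ true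
⇒ᵇ-∨-introˡ false b = refl
⇒ᵇ-∨-introˡ true  b = refl

⇒ᵇ-∨-introʳ : ∀ a b → (b ⇒ᵇ (a ∨ b)) ≡ true
⇒ᵇ-∨-introʳ a false = refl
⇒ᵇ-∨-introʳ a true  = ∨-zeroʳ a

⇒ᵇ-∨-elim : ∀ a b c → ((a ⇒ᵇ c) ⇒ᵇ ((b ⇒ᵇ c) ⇒ᵇ ((a ∨ b) ⇒ᵇ c))) ≡ true
⇒ᵇ-∨-elim false b c     = ∨-inverseˡ (b ⇒ᵇ c)
⇒ᵇ-∨-elim true  b false = refl
⇒ᵇ-∨-elim true  b true  = ∨-zeroʳ (not (b ⇒ᵇ true))

∨-⇒ᵇ-excluded-middle : ∀ a b → (a ∨ (a ⇒ᵇ b)) ≡ true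
∨-⇒ᵇ-excluded-middle false b = refl
∨-⇒ᵇ-excluded-middle true  b = refl

⇒ᵇ-explosion : ∀ a b c → (not (a ∧ b) ⇒ᵇ (a ⇒ᵇ (b ⇒ᵇ c))) ≡ true
⇒ᵇ-explosion false b     c = refl
⇒ᵇ-explosion true  false c = refl
⇒ᵇ-explosion true  true  c = refl

∘ᵗ : Triple → Triple
∘ᵗ x = (not (fst x ∧ snd x) , thd x , thd x ∧ not (fst x ∧ snd x))

∘ᵗ∘ᵗ-complementary : ∀ x → fst (∘ᵗ (∘ᵗ x)) ≡ not (snd (∘ᵗ (∘ᵗ x)))
∘ᵗ∘ᵗ-complementary x = cong not (∧-comm (not (fst x ∧ snd x)) (thd x))

∘ᵗ∘ᵗ∘ᵗ-designated : ∀ x → Designated (∘ᵗ (∘ᵗ (∘ᵗ x)))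
∘ᵗ∘ᵗ∘ᵗ-designated x = begin
  not (fst y ∧ snd y)        ≡⟨ cong (λ a → not (a ∧ snd y)) (∘ᵗ∘ᵗ-complementary x) ⟩
  not (not (snd y) ∧ snd y)  ≡⟨ cong not (∧-inverseˡ (snd y)) ⟩
  true                       ∎
  where
  y : Triple
  y = ∘ᵗ (∘ᵗ x)

module _ (val : Valuation) where
  open Valuation val

  truth : Formula → Bool
  truth φ = fst (v φ)

  -- truth φ unfolded through all connectives, so that ⟦ φ ⟧ of an axiom
  -- reduces to a Boolean tautology in ⟦ α ⟧, snd (v α), ….
  ⟦_⟧ : Formula → Bool
  ⟦ var n ⟧   = truth (var n)
  ⟦ ¬ᶠ α ⟧    = snd (v α)
  ⟦ ∘ᶠ α ⟧    = not (⟦ α ⟧ ∧ snd (v α))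
  ⟦ α ∧ᶠ β ⟧  = ⟦ α ⟧ ∧ ⟦ β ⟧
  ⟦ α ∨ᶠ β ⟧  = ⟦ α ⟧ ∨ ⟦ β ⟧
  ⟦ α ⇒ β ⟧   = ⟦ α ⟧ ⇒ᵇ ⟦ β ⟧

  truth≡⟦⟧ : ∀ φ → truth φ ≡ ⟦ φ ⟧
  truth≡⟦⟧ (var n)  = refl
  truth≡⟦⟧ (¬ᶠ α)   = proj₂ (v-neg α)
  truth≡⟦⟧ (∘ᶠ α)   = trans (cong fst (v-circ α)) (cong (λ a → not (a ∧ snd (v α))) (truth≡⟦⟧ α))
  truth≡⟦⟧ (α ∧ᶠ β) = trans (proj₂ (v-and α β)) (cong₂ _∧_ (truth≡⟦⟧ α) (truth≡⟦⟧ β))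
  truth≡⟦⟧ (α ∨ᶠ β) = trans (proj₂ (v-or α β)) (cong₂ _∨_ (truth≡⟦⟧ α) (truth≡⟦⟧ β))
  truth≡⟦⟧ (α ⇒ β)  = trans (proj₂ (v-imp α β)) (cong₂ _⇒ᵇ_ (truth≡⟦⟧ α) (truth≡⟦⟧ β))

  v-∘∘∘ : ∀ α → v (∘ᶠ ∘ᶠ ∘ᶠ α) ≡ ∘ᵗ (∘ᵗ (∘ᵗ (v α)))
  v-∘∘∘ α = trans (v-circ _) (cong ∘ᵗ (trans (v-circ _) (cong ∘ᵗ (v-circ α))))

  ⟦axiom⟧ : ∀ {φ} → AxiomL10 φ → ⟦ φ ⟧ ≡ true
  ⟦axiom⟧ (ax1 α β)   = ⇒ᵇ-K ⟦ α ⟧ ⟦ β ⟧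
  ⟦axiom⟧ (ax2 α β γ) = ⇒ᵇ-S ⟦ α ⟧ ⟦ β ⟧ ⟦ γ ⟧
  ⟦axiom⟧ (ax3 α β)   = ⇒ᵇ-∧-intro ⟦ α ⟧ ⟦ β ⟧
  ⟦axiom⟧ (ax4 α β)   = ⇒ᵇ-∧-elimˡ ⟦ α ⟧ ⟦ β ⟧
  ⟦axiom⟧ (ax5 α β)   = ⇒ᵇ-∧-elimʳ ⟦ α ⟧ ⟦ β ⟧
  ⟦axiom⟧ (ax6 α β)   = ⇒ᵇ-∨-introˡ ⟦ α ⟧ ⟦ β ⟧
  ⟦axiom⟧ (ax7 α β)   = ⇒ᵇ-∨-introʳ ⟦ α ⟧ ⟦ β ⟧
  ⟦axiom⟧ (ax8 α β γ) = ⇒ᵇ-∨-elim ⟦ α ⟧ ⟦ β ⟧ ⟦ γ ⟧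
  ⟦axiom⟧ (ax9 α β)   = ∨-⇒ᵇ-excluded-middle ⟦ α ⟧ ⟦ β ⟧
  ⟦axiom⟧ (tnd α)     = subst (λ a → (a ∨ snd (v α)) ≡ true) (truth≡⟦⟧ α) (proj₁ (inB α))
  ⟦axiom⟧ (bc1 α β)   = ⇒ᵇ-explosion ⟦ α ⟧ (snd (v α)) ⟦ β ⟧
  ⟦axiom⟧ (ciw α)     = ∨-inverseˡ (⟦ α ⟧ ∧ snd (v α))
  ⟦axiom⟧ (ooo α)     = begin
    ⟦ ∘ᶠ ∘ᶠ ∘ᶠ α ⟧               ≡⟨ sym (truth≡⟦⟧ (∘ᶠ ∘ᶠ ∘ᶠ α)) ⟩
    fst (v (∘ᶠ ∘ᶠ ∘ᶠ α))         ≡⟨ cong fst (v-∘∘∘ α) ⟩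
    fst (∘ᵗ (∘ᵗ (∘ᵗ (v α))))     ≡⟨ ∘ᵗ∘ᵗ∘ᵗ-designated (v α) ⟩
    true                         ∎

  axiom-designated : ∀ {φ} → AxiomL10 φ → Designated (v φ)
  axiom-designated {φ} ax = trans (truth≡⟦⟧ φ) (⟦axiom⟧ ax)

  mp-designated : ∀ {α β} → Designated (v α) → Designated (v (α ⇒ β)) → Designated (v β)
  mp-designated {α} {β} α-designated α⇒β-designated = begin
    truth β                  ≡⟨ cong (_⇒ᵇ truth β) (sym α-designated) ⟩
    truth α ⇒ᵇ truth β       ≡⟨ sym (proj₂ (v-imp α β)) ⟩
    truth (α ⇒ β)            ≡⟨ α⇒β-designated ⟩
    true                     ∎

theorem2 : (Γ : FSet) (α : Formula) → Γ ⊢L10 α → Γ ⊨M10 α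
theorem2 Γ α (premise γ)  val Γ-designated = Γ-designated α γ
theorem2 Γ α (axiom ax)   val Γ-designated = axiom-designated val ax
theorem2 Γ β (mp {α} d e) val Γ-designated =
  mp-designated val (theorem2 Γ α d val Γ-designated) (theorem2 Γ (α ⇒ β) e val Γ-designated)
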